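{- Let $d,t,m$ be positive integers with $t=\Theta(\sqrt{d})$, $m=\Theta(2^t)$, and $2^{ -t}m$ sufficiently small as a function of $t/\sqrt{d}$ (as $d\to\infty$). Let $\mathcal{S}=(S_1,\ldots,S_m)$ where the $S_i$ are chosen independently and uniformly at random among the subsets of $\{1,\ldots,d-1\}$ of size exactly $t$, let $x$ be uniform in $\{0,1\}^{d-1}$ independent of $\mathcal{S}$, and let $T_{\mathcal{S}}(x)=\{1\le i\le m : x_j=1 \text{ for all } j\in S_i\}$. Then $\Pr_{\mathcal{S},x}(|T_{\mathcal{S}}(x)|=1)=\Omega(1)$, i.e. it is bounded below by a positive constant independent of $d$. -}

module Defs where

open import Data.Nat using (ℕ; zero; suc; _+_; _*_; _∸_; _^_)
open import Data.Bool using (Bool; true; false)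
open import Data.List using (List; []; _∷_; map; concatMap; length; filter)
open import Data.Vec using (Vec; []; _∷_; toList)
open import Data.Fin.Subset using (Subset; ∣_∣; _⊆_; inside; outside)
open import Data.Fin.Subset.Properties using (_⊆?_)
open import Data.Integer using (+_)
open import Data.Rational using (ℚ; _/_)
open import Relation.Nullary using (does)
open import Data.Nat using (_≟_)

ℕ→ℚ : ℕ → ℚ
ℕ→ℚ n = (+ n) / 1

-- All subsets of {0,…,n-1} (equivalently all x ∈ {0,1}^n).
allSubsets : (n : ℕ) → List (Subset n)
allSubsets zero    = [] ∷ []
allSubsets (suc n) = concatMap (λ s → (outside ∷ s) ∷ (inside ∷ s) ∷ []) (allSubsets n)

subsetsOfSize : (n t : ℕ) → List (Subset n)
subsetsOfSize n t = filter (λ s → ∣ s ∣ ≟ t) (allSubsets n)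

tuples : {A : Set} → List A → (m : ℕ) → List (Vec A m)
tuples xs zero    = [] ∷ []
tuples xs (suc m) = concatMap (λ x → map (x ∷_) (tuples xs m)) xs

-- |T_S(x)| = #{ i : S_i ⊆ x }  (i.e. x_j = 1 for all j ∈ S_i)
countT : {n m : ℕ} → Vec (Subset n) m → Subset n → ℕ
countT []       x = 0
countT (S ∷ Ss) x = (if does (S ⊆? x) then 1 else 0) + countT Ss x
  where open import Data.Bool using (if_then_else_)

-- Sample space: all (S, x) with S an m-tuple of t-subsets of {1..n}, x ∈ {0,1}^n.
-- Under the uniform product measure each outcome has equal probability.
record Outcome (n m : ℕ) : Set where
  constructor ⟨_,_⟩
  field
    sys : Vec (Subset n) m
    pt  : Subset n

outcomes : (n t m : ℕ) → List (Outcome n m)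
outcomes n t m = concatMap (λ S → map (λ x → ⟨ S , x ⟩) (allSubsets n)) (tuples (subsetsOfSize n t) m)

favourable : (n t m : ℕ) → ℕ
favourable n t m = length (filter (λ o → countT (Outcome.sys o) (Outcome.pt o) ≟ 1) (outcomes n t m))

total : (n t m : ℕ) → ℕ
total n t m = length (outcomes n t m)

probUnique : (d t m : ℕ) → ℚ
probUnique d t m with total (d ∸ 1) t m
... | zero  = ℕ→ℚ 0
... | suc k = (+ favourable (d ∸ 1) t m) / suc k

module Submission where

-- Notation: n = d - 1, 𝓛 = the t-subsets of [n], N = |𝓛| = n C t, τ = 2^t.
-- For S⃗ ∈ 𝓛^m and x ∈ 2^[n] let T(S⃗,x) = #{i : S_i ⊆ x} and
-- P(S⃗,x) = #{i < j : S_i ∪ S_j ⊆ x}.  Summing over all outcomes (S⃗, x):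
--   (1) T ≤ [T = 1] + 2P pointwise;
--   (2) τ · ΣT = m N^m 2^n, since each S is contained in 2^(n-t) points x;
--   (3) τ² · 2ΣP ≤ m K · m N^m 2^n, where K = 2^c bounds the average of
--       2^|S ∩ S'| over S' ∈ 𝓛; this is where t = O(√d) is used.
-- If 2Km ≤ τ (the hypothesis "2^-t m small") then (1)-(3) give
-- #{T = 1} ≥ m N^m 2^n / 2τ, and τ ≤ Q m ("m = Ω(2^t)") turns this into
-- #outcomes ≤ 2Q · #{T = 1}.

open import Defs
open import Data.Bool using (true; false; if_then_else_)
open import Data.Nat using (ℕ; zero; suc; _+_; _*_; _^_; _∸_; _/_; _%_; _≤_; _<_; _≥_; z≤n; s≤s; _≟_; _≤?_; NonZero; >-nonZero)
open import Data.Nat.DivMod using (m≡m%n+[m/n]*n; m%n<n; m/n*n≤m)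
open import Data.Empty using (⊥-elim)
open import Data.Nat.Properties
open import Data.Nat.Combinatorics using (_C_; nC1≡n; nCk+nC[k+1]≡[n+1]C[k+1])
open import Data.Nat.Tactic.RingSolver using (solve-∀)
open import Data.List using (List; []; _∷_; map; concatMap; length; filter; _++_)
open import Data.List.Membership.Propositional using (_∈_)
open import Data.List.Membership.Propositional.Properties using (∈-filter⁻)
open import Data.List.Relation.Unary.Any using (here; there)
open import Data.Vec using (Vec; []; _∷_)
open import Data.Fin.Subset using (Subset; ∣_∣; _∩_; ∁; inside; outside)
open import Data.Fin.Subset.Properties using (_⊆?_; ∩-idem; ∣∁p∣≡n∸∣p∣)
open import Data.Product using (Σ; _×_; _,_; proj₁; proj₂)
open import Relation.Nullary using (Dec; does; yes; no)
open import Relation.Binary.PropositionalEquality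
import Data.Integer as ℤ
import Data.Integer.Properties as ℤP
open import Data.Rational as ℚ using (ℚ; mkℚ; 0ℚ; 1ℚ; 1/_; *≤*; *<*)
import Data.Rational.Properties as ℚP
import Data.Rational.Unnormalised as ℚᵘ
import Data.Rational.Unnormalised.Properties as ℚᵘP
import Data.Nat.Coprimality as Coprime

∑ : {A : Set} → List A → (A → ℕ) → ℕ
∑ []       f = 0
∑ (x ∷ xs) f = f x + ∑ xs f

infix 7 ∑
syntax ∑ xs (λ x → e) = ∑[ x ∈ xs ] e

∑-++ : {A : Set} (xs ys : List A) (f : A → ℕ) → ∑ (xs ++ ys) f ≡ ∑ xs f + ∑ ys f
∑-++ []       ys f = refl
∑-++ (x ∷ xs) ys f = trans (cong (f x +_) (∑-++ xs ys f)) (sym (+-assoc (f x) _ _))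

module _ {A : Set} where

  ∑-concatMap : {B : Set} (g : A → List B) (xs : List A) (f : B → ℕ) →
                ∑ (concatMap g xs) f ≡ ∑[ x ∈ xs ] ∑ (g x) f
  ∑-concatMap g []       f = refl
  ∑-concatMap g (x ∷ xs) f =
    trans (∑-++ (g x) (concatMap g xs) f) (cong (∑ (g x) f +_) (∑-concatMap g xs f))

  ∑-map : {B : Set} (h : A → B) (xs : List A) (f : B → ℕ) → ∑ (map h xs) f ≡ ∑[ x ∈ xs ] f (h x)
  ∑-map h []       f = refl
  ∑-map h (x ∷ xs) f = cong (f (h x) +_) (∑-map h xs f)

  ∑-cong : (xs : List A) {f g : A → ℕ} → (∀ x → x ∈ xs → f x ≡ g x) → ∑ xs f ≡ ∑ xs g
  ∑-cong []       e = refl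
  ∑-cong (x ∷ xs) e = cong₂ _+_ (e x (here refl)) (∑-cong xs (λ y y∈ → e y (there y∈)))

  ∑-mono : (xs : List A) {f g : A → ℕ} → (∀ x → x ∈ xs → f x ≤ g x) → ∑ xs f ≤ ∑ xs g
  ∑-mono []       e = z≤n
  ∑-mono (x ∷ xs) e = +-mono-≤ (e x (here refl)) (∑-mono xs (λ y y∈ → e y (there y∈)))

  ∑-+ : (xs : List A) (f g : A → ℕ) → ∑[ x ∈ xs ] (f x + g x) ≡ ∑ xs f + ∑ xs g
  ∑-+ []       f g = refl
  ∑-+ (x ∷ xs) f g = trans (cong (f x + g x +_) (∑-+ xs f g)) (swap (f x) (g x) (∑ xs f) (∑ xs g))
    where swap : ∀ a b c d → a + b + (c + d) ≡ a + c + (b + d)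
          swap = solve-∀

  ∑-*ˡ : (xs : List A) (k : ℕ) (f : A → ℕ) → ∑[ x ∈ xs ] (k * f x) ≡ k * ∑ xs f
  ∑-*ˡ []       k f = sym (*-zeroʳ k)
  ∑-*ˡ (x ∷ xs) k f = trans (cong (k * f x +_) (∑-*ˡ xs k f)) (sym (*-distribˡ-+ k (f x) _))

  ∑-const : (xs : List A) (k : ℕ) → ∑[ _ ∈ xs ] k ≡ length xs * k
  ∑-const []       k = refl
  ∑-const (x ∷ xs) k = cong (k +_) (∑-const xs k)

  ∑-zero : (xs : List A) → ∑[ _ ∈ xs ] 0 ≡ 0
  ∑-zero xs = trans (∑-const xs 0) (*-zeroʳ (length xs))

  length≡∑1 : (xs : List A) → length xs ≡ ∑[ _ ∈ xs ] 1
  length≡∑1 xs = sym (trans (∑-const xs 1) (*-identityʳ (length xs)))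

  ∑-filter : {P : A → Set} (P? : (x : A) → Dec (P x)) (xs : List A) (f : A → ℕ) →
             ∑ (filter P? xs) f ≡ ∑[ x ∈ xs ] (if does (P? x) then f x else 0)
  ∑-filter P? []       f = refl
  ∑-filter P? (x ∷ xs) f with does (P? x)
  ... | true  = cong (f x +_) (∑-filter P? xs f)
  ... | false = ∑-filter P? xs f

∑-cube-suc : (n : ℕ) (f : Subset (suc n) → ℕ) →
             ∑ (allSubsets (suc n)) f ≡ ∑[ x ∈ allSubsets n ] (f (outside ∷ x) + f (inside ∷ x))
∑-cube-suc n f = trans (∑-concatMap _ (allSubsets n) f)
  (∑-cong (allSubsets n) (λ x _ → cong (f (outside ∷ x) +_) (+-identityʳ _)))

cube-size : (n : ℕ) → length (allSubsets n) ≡ 2 ^ n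
cube-size n = trans (length≡∑1 (allSubsets n)) (count n)
  where
  count : (n : ℕ) → ∑[ _ ∈ allSubsets n ] 1 ≡ 2 ^ n
  count zero    = refl
  count (suc n) = begin
    ∑[ _ ∈ allSubsets (suc n) ] 1  ≡⟨ ∑-cube-suc n (λ _ → 1) ⟩
    ∑[ _ ∈ allSubsets n ] 2        ≡⟨ ∑-const (allSubsets n) 2 ⟩
    length (allSubsets n) * 2      ≡⟨ cong (_* 2) (length≡∑1 (allSubsets n)) ⟩
    (∑[ _ ∈ allSubsets n ] 1) * 2  ≡⟨ cong (_* 2) (count n) ⟩
    2 ^ n * 2                      ≡⟨ *-comm (2 ^ n) 2 ⟩
    2 ^ suc n                      ∎
    where open ≡-Reasoning

covers : {n : ℕ} → Subset n → Subset n → ℕ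
covers S x = if does (S ⊆? x) then 1 else 0

covers-idem : {n : ℕ} (S x : Subset n) → covers S x * covers S x ≡ covers S x
covers-idem S x with does (S ⊆? x)
... | true  = refl
... | false = refl

x*[2*y]≡2*[x*y] : ∀ x y → x * (2 * y) ≡ 2 * (x * y)
x*[2*y]≡2*[x*y] = solve-∀

jointCover : {n : ℕ} → Subset n → Subset n → ℕ
jointCover {n} S S' = ∑[ x ∈ allSubsets n ] (covers S x * covers S' x)

-- Pr_x(S ∪ S' ⊆ x) = 2^-|S ∪ S'| = 2^|S ∩ S'| / 2^(|S| + |S'|).
jointCover-exact : {n : ℕ} (S S' : Subset n) →
                   jointCover S S' * 2 ^ (∣ S ∣ + ∣ S' ∣) ≡ 2 ^ n * 2 ^ ∣ S ∩ S' ∣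
jointCover-exact []          []           = refl
jointCover-exact {suc n} (false ∷ S) (false ∷ S') = begin
  jointCover (false ∷ S) (false ∷ S') * 2 ^ e ≡⟨ cong (_* 2 ^ e) (trans (∑-cube-suc n _) (∑-+ (allSubsets n) both both)) ⟩
  (jointCover S S' + jointCover S S') * 2 ^ e  ≡⟨ double (jointCover S S') (2 ^ e) ⟩
  2 * (jointCover S S' * 2 ^ e)                ≡⟨ cong (2 *_) (jointCover-exact S S') ⟩
  2 * (2 ^ n * 2 ^ ∣ S ∩ S' ∣)                   ≡⟨ *-assoc 2 (2 ^ n) _ ⟨
  2 ^ suc n * 2 ^ ∣ S ∩ S' ∣                    ∎
  where open ≡-Reasoning
        e = ∣ S ∣ + ∣ S' ∣
        both = λ x → covers S x * covers S' x
        double : ∀ a b → (a + a) * b ≡ 2 * (a * b)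
        double = solve-∀
jointCover-exact {suc n} (false ∷ S) (true ∷ S') = begin
  jointCover (false ∷ S) (true ∷ S') * 2 ^ (∣ S ∣ + suc ∣ S' ∣)
    ≡⟨ cong₂ (λ j k → j * 2 ^ k) (trans (∑-cube-suc n _) (∑-cong (allSubsets n) (λ x _ →
         cong (_+ covers S x * covers S' x) (*-zeroʳ (covers S x))))) (+-suc ∣ S ∣ ∣ S' ∣) ⟩
  jointCover S S' * (2 * 2 ^ (∣ S ∣ + ∣ S' ∣))  ≡⟨ x*[2*y]≡2*[x*y] (jointCover S S') _ ⟩
  2 * (jointCover S S' * 2 ^ (∣ S ∣ + ∣ S' ∣))  ≡⟨ cong (2 *_) (jointCover-exact S S') ⟩
  2 * (2 ^ n * 2 ^ ∣ S ∩ S' ∣)                   ≡⟨ *-assoc 2 (2 ^ n) _ ⟨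
  2 ^ suc n * 2 ^ ∣ S ∩ S' ∣                     ∎
  where open ≡-Reasoning
jointCover-exact {suc n} (true ∷ S) (false ∷ S') = begin
  jointCover (true ∷ S) (false ∷ S') * 2 ^ suc (∣ S ∣ + ∣ S' ∣)
    ≡⟨ cong (_* 2 ^ suc (∣ S ∣ + ∣ S' ∣)) (∑-cube-suc n _) ⟩
  jointCover S S' * (2 * 2 ^ (∣ S ∣ + ∣ S' ∣))  ≡⟨ x*[2*y]≡2*[x*y] (jointCover S S') _ ⟩
  2 * (jointCover S S' * 2 ^ (∣ S ∣ + ∣ S' ∣))  ≡⟨ cong (2 *_) (jointCover-exact S S') ⟩
  2 * (2 ^ n * 2 ^ ∣ S ∩ S' ∣)                   ≡⟨ *-assoc 2 (2 ^ n) _ ⟨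
  2 ^ suc n * 2 ^ ∣ S ∩ S' ∣                     ∎
  where open ≡-Reasoning
jointCover-exact {suc n} (true ∷ S) (true ∷ S') = begin
  jointCover (true ∷ S) (true ∷ S') * 2 ^ (suc ∣ S ∣ + suc ∣ S' ∣)
    ≡⟨ cong₂ (λ j k → j * 2 ^ suc k) (∑-cube-suc n _) (+-suc ∣ S ∣ ∣ S' ∣) ⟩
  jointCover S S' * (2 * (2 * 2 ^ (∣ S ∣ + ∣ S' ∣)))  ≡⟨ regroup (jointCover S S') _ ⟩
  2 * 2 * (jointCover S S' * 2 ^ (∣ S ∣ + ∣ S' ∣))    ≡⟨ cong (2 * 2 *_) (jointCover-exact S S') ⟩
  2 * 2 * (2 ^ n * 2 ^ ∣ S ∩ S' ∣)                     ≡⟨ regroup′ (2 ^ n) _ ⟩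
  2 ^ suc n * 2 ^ suc ∣ S ∩ S' ∣                       ∎
  where open ≡-Reasoning
        regroup : ∀ a b → a * (2 * (2 * b)) ≡ 2 * 2 * (a * b)
        regroup = solve-∀
        regroup′ : ∀ a b → 2 * 2 * (a * b) ≡ 2 * a * (2 * b)
        regroup′ = solve-∀

covers-count : {n : ℕ} (S : Subset n) → (∑[ x ∈ allSubsets n ] covers S x) * 2 ^ ∣ S ∣ ≡ 2 ^ n
covers-count {n} S = *-cancelʳ-≡ _ _ (2 ^ ∣ S ∣) {{m^n≢0 2 ∣ S ∣}} (begin
  ∑ (allSubsets n) (covers S) * 2 ^ ∣ S ∣ * 2 ^ ∣ S ∣   ≡⟨ *-assoc (∑ (allSubsets n) (covers S)) (2 ^ ∣ S ∣) _ ⟩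
  ∑ (allSubsets n) (covers S) * (2 ^ ∣ S ∣ * 2 ^ ∣ S ∣) ≡⟨ cong₂ _*_ joint≡cover (^-distribˡ-+-* 2 ∣ S ∣ ∣ S ∣) ⟨
  jointCover S S * 2 ^ (∣ S ∣ + ∣ S ∣)                  ≡⟨ jointCover-exact S S ⟩
  2 ^ n * 2 ^ ∣ S ∩ S ∣                                  ≡⟨ cong (λ s → 2 ^ n * 2 ^ ∣ s ∣) (∩-idem S) ⟩
  2 ^ n * 2 ^ ∣ S ∣                                      ∎)
  where open ≡-Reasoning
        joint≡cover : jointCover S S ≡ ∑ (allSubsets n) (covers S)
        joint≡cover = ∑-cong (allSubsets n) (λ x _ → covers-idem S x)

pascal : ∀ n k → suc n C suc k ≡ n C suc k + n C k
pascal n k = trans (sym (nCk+nC[k+1]≡[n+1]C[k+1] n k)) (+-comm (n C k) _)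

hasSize : {n : ℕ} → ℕ → Subset n → ℕ
hasSize k s = if does (∣ s ∣ ≟ k) then 1 else 0

hasSize-count : (n k : ℕ) → ∑ (allSubsets n) (hasSize k) ≡ n C k
hasSize-count zero    zero    = refl
hasSize-count zero    (suc k) = refl
hasSize-count (suc n) zero    =
  trans (∑-cube-suc n _) (trans (∑-cong (allSubsets n) (λ s _ → +-identityʳ _)) (hasSize-count n zero))
hasSize-count (suc n) (suc k) = begin
  ∑ (allSubsets (suc n)) (hasSize (suc k))                       ≡⟨ ∑-cube-suc n _ ⟩
  ∑[ s ∈ allSubsets n ] (hasSize (suc k) s + hasSize k s)        ≡⟨ ∑-+ (allSubsets n) _ _ ⟩
  ∑ (allSubsets n) (hasSize (suc k)) + ∑ (allSubsets n) (hasSize k)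
    ≡⟨ cong₂ _+_ (hasSize-count n (suc k)) (hasSize-count n k) ⟩
  n C suc k + n C k                                              ≡⟨ pascal n k ⟨
  suc n C suc k                                                  ∎
  where open ≡-Reasoning

subsetsOfSize-length : (n k : ℕ) → length (subsetsOfSize n k) ≡ n C k
subsetsOfSize-length n k = begin
  length (subsetsOfSize n k)         ≡⟨ length≡∑1 (subsetsOfSize n k) ⟩
  ∑[ _ ∈ subsetsOfSize n k ] 1       ≡⟨ ∑-filter (λ s → ∣ s ∣ ≟ k) (allSubsets n) (λ _ → 1) ⟩
  ∑ (allSubsets n) (hasSize k)       ≡⟨ hasSize-count n k ⟩
  n C k                              ∎
  where open ≡-Reasoning

C-pos : ∀ n k → k ≤ n → 0 < n C k
C-pos n       zero    _         = s≤s z≤n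
C-pos (suc n) (suc k) (s≤s k≤n) =
  ≤-trans (C-pos n k k≤n) (≤-trans (m≤n+m (n C k) (n C suc k)) (≤-reflexive (sym (pascal n k))))

C-monoˡ : ∀ r n k → r ≤ n → r C k ≤ n C k
C-monoˡ r       n       zero    _         = ≤-refl
C-monoˡ zero    n       (suc k) _         = z≤n
C-monoˡ (suc r) (suc n) (suc k) (s≤s r≤n) = begin
  suc r C suc k     ≡⟨ pascal r k ⟩
  r C suc k + r C k ≤⟨ +-mono-≤ (C-monoˡ r n (suc k) r≤n) (C-monoˡ r n k r≤n) ⟩
  n C suc k + n C k ≡⟨ pascal n k ⟨
  suc n C suc k     ∎
  where open ≤-Reasoning

C-absorption : ∀ r k → suc k * (suc r C suc k) ≡ suc r * (r C k)
C-absorption r       zero    =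
  trans (*-identityˡ _) (trans (nC1≡n (suc r)) (sym (*-identityʳ (suc r))))
C-absorption zero    (suc k) = *-zeroʳ (suc (suc k))
C-absorption (suc r) (suc k) = begin
  suc (suc k) * (suc (suc r) C suc (suc k))
    ≡⟨ cong (suc (suc k) *_) (pascal (suc r) (suc k)) ⟩
  suc (suc k) * (suc r C suc (suc k) + suc r C suc k)
    ≡⟨ split (suc k) (suc r C suc (suc k)) (suc r C suc k) ⟩
  suc (suc k) * (suc r C suc (suc k)) + (suc k * (suc r C suc k) + suc r C suc k)
    ≡⟨ cong₂ (λ x y → x + (y + suc r C suc k)) (C-absorption r (suc k)) (C-absorption r k) ⟩
  suc r * (r C suc k) + (suc r * (r C k) + suc r C suc k)
    ≡⟨ cong (λ z → suc r * (r C suc k) + (suc r * (r C k) + z)) (pascal r k) ⟩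
  suc r * (r C suc k) + (suc r * (r C k) + (r C suc k + r C k))
    ≡⟨ merge r (r C suc k) (r C k) ⟩
  suc (suc r) * (r C suc k + r C k)
    ≡⟨ cong (suc (suc r) *_) (pascal r k) ⟨
  suc (suc r) * (suc r C suc k)
    ∎
  where open ≡-Reasoning
        split : ∀ k a b → suc k * (a + b) ≡ suc k * a + (k * b + b)
        split = solve-∀
        merge : ∀ r a b → suc r * a + (suc r * b + (a + b)) ≡ suc (suc r) * (a + b)
        merge = solve-∀

-- Ratio of consecutive binomials: C(r,k+1)/C(r,k) = (r-k)/(k+1) ≥ q/t
-- whenever q + t = r + 1 and k < t.
C-ratio : ∀ q t r k → q + t ≡ suc r → suc k ≤ t → q * (r C k) ≤ t * (r C suc k)
C-ratio q t r k q+t≡1+r k<t = +-cancelʳ-≤ (t * (r C k)) _ _ (begin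
  q * (r C k) + t * (r C k)                 ≡⟨ *-distribʳ-+ (r C k) q t ⟨
  (q + t) * (r C k)                         ≡⟨ cong (_* (r C k)) q+t≡1+r ⟩
  suc r * (r C k)                           ≡⟨ C-absorption r k ⟨
  suc k * (suc r C suc k)                   ≡⟨ cong (suc k *_) (pascal r k) ⟩
  suc k * (r C suc k + r C k)               ≡⟨ *-distribˡ-+ (suc k) (r C suc k) (r C k) ⟩
  suc k * (r C suc k) + suc k * (r C k)     ≤⟨ +-mono-≤ (*-monoˡ-≤ (r C suc k) k<t) (*-monoˡ-≤ (r C k) k<t) ⟩
  t * (r C suc k) + t * (r C k)             ∎)
  where open ≤-Reasoning

-- Intersection-weighted counts
--
-- For a fixed S ⊆ [n] we need Σ 2^|S ∩ s| over the k-subsets s of [n].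
-- Splitting [n] into the |S| points of S ("marked") and the |∁ S| others,
-- this is the coefficient of x^k in (1 + 2x)^|S| (1 + x)^|∁ S|.

-- weighted s r k = [x^k] (1 + 2x)^s (1 + x)^r, by recursion on s.
weighted : ℕ → ℕ → ℕ → ℕ
weighted zero    r k       = r C k
weighted (suc s) r zero    = weighted s r zero
weighted (suc s) r (suc k) = weighted s r (suc k) + 2 * weighted s r k

weighted-zero : ∀ s r → weighted s r 0 ≡ 1
weighted-zero zero    r = refl
weighted-zero (suc s) r = weighted-zero s r

-- Multiplying by one more factor (1 + x): the recursion in r.
weighted-unmarked : ∀ s r k → weighted s (suc r) (suc k) ≡ weighted s r (suc k) + weighted s r k
weighted-unmarked zero    r k       = pascal r k
weighted-unmarked (suc s) r zero    = begin
  weighted s (suc r) 1 + 2 * weighted s (suc r) 0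
    ≡⟨ cong₂ (λ x y → x + 2 * y) (weighted-unmarked s r zero) (weighted-zero s (suc r)) ⟩
  weighted s r 1 + weighted s r 0 + 2 * 1
    ≡⟨ cong (λ z → weighted s r 1 + z + 2 * 1) (weighted-zero s r) ⟩
  weighted s r 1 + 1 + 2 * 1
    ≡⟨ swap (weighted s r 1) ⟩
  weighted s r 1 + 2 * 1 + 1
    ≡⟨ cong (weighted s r 1 + 2 * 1 +_) (weighted-zero s r) ⟨
  weighted s r 1 + 2 * 1 + weighted s r 0
    ≡⟨ cong (λ z → weighted s r 1 + 2 * z + weighted s r 0) (weighted-zero s r) ⟨
  weighted s r 1 + 2 * weighted s r 0 + weighted s r 0
    ∎
  where open ≡-Reasoning
        swap : ∀ a → a + 1 + 2 * 1 ≡ a + 2 * 1 + 1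
        swap = solve-∀
weighted-unmarked (suc s) r (suc k) = begin
  weighted s (suc r) (suc (suc k)) + 2 * weighted s (suc r) (suc k)
    ≡⟨ cong₂ (λ x y → x + 2 * y) (weighted-unmarked s r (suc k)) (weighted-unmarked s r k) ⟩
  weighted s r (suc (suc k)) + weighted s r (suc k) + 2 * (weighted s r (suc k) + weighted s r k)
    ≡⟨ regroup (weighted s r (suc (suc k))) (weighted s r (suc k)) (weighted s r k) ⟩
  weighted s r (suc (suc k)) + 2 * weighted s r (suc k) + (weighted s r (suc k) + 2 * weighted s r k)
    ∎
  where open ≡-Reasoning
        regroup : ∀ a b c → a + b + 2 * (b + c) ≡ a + 2 * b + (b + 2 * c)
        regroup = solve-∀

weightIfSize : {n : ℕ} → Subset n → ℕ → Subset n → ℕ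
weightIfSize S k s = if does (∣ s ∣ ≟ k) then 2 ^ ∣ S ∩ s ∣ else 0

weightIfSize-double : {n : ℕ} (S s : Subset n) (k : ℕ) →
                      weightIfSize (inside ∷ S) (suc k) (inside ∷ s) ≡ 2 * weightIfSize S k s
weightIfSize-double S s k with does (∣ s ∣ ≟ k)
... | true  = refl
... | false = refl

intersection-weighted : {n : ℕ} (S : Subset n) (k : ℕ) →
                        ∑ (allSubsets n) (weightIfSize S k) ≡ weighted (∣ S ∣) (∣ ∁ S ∣) k
intersection-weighted []          zero    = refl
intersection-weighted []          (suc k) = refl
intersection-weighted {suc n} (true ∷ S) zero =
  trans (∑-cube-suc n _) (trans (∑-cong (allSubsets n) (λ s _ → +-identityʳ _)) (intersection-weighted S zero))
intersection-weighted {suc n} (true ∷ S) (suc k) = begin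
  ∑ (allSubsets (suc n)) (weightIfSize (true ∷ S) (suc k))
    ≡⟨ ∑-cube-suc n _ ⟩
  ∑[ s ∈ allSubsets n ] (weightIfSize S (suc k) s + weightIfSize (true ∷ S) (suc k) (true ∷ s))
    ≡⟨ ∑-cong (allSubsets n) (λ s _ → cong (weightIfSize S (suc k) s +_) (weightIfSize-double S s k)) ⟩
  ∑[ s ∈ allSubsets n ] (weightIfSize S (suc k) s + 2 * weightIfSize S k s)
    ≡⟨ ∑-+ (allSubsets n) _ _ ⟩
  ∑ (allSubsets n) (weightIfSize S (suc k)) + ∑[ s ∈ allSubsets n ] (2 * weightIfSize S k s)
    ≡⟨ cong (∑ (allSubsets n) (weightIfSize S (suc k)) +_) (∑-*ˡ (allSubsets n) 2 (weightIfSize S k)) ⟩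
  ∑ (allSubsets n) (weightIfSize S (suc k)) + 2 * ∑ (allSubsets n) (weightIfSize S k)
    ≡⟨ cong₂ (λ x y → x + 2 * y) (intersection-weighted S (suc k)) (intersection-weighted S k) ⟩
  weighted (∣ S ∣) (∣ ∁ S ∣) (suc k) + 2 * weighted (∣ S ∣) (∣ ∁ S ∣) k
    ∎
  where open ≡-Reasoning
intersection-weighted {suc n} (false ∷ S) zero = begin
  ∑ (allSubsets (suc n)) (weightIfSize (false ∷ S) zero)
    ≡⟨ trans (∑-cube-suc n _) (∑-cong (allSubsets n) (λ s _ → +-identityʳ _)) ⟩
  ∑ (allSubsets n) (weightIfSize S zero)
    ≡⟨ intersection-weighted S zero ⟩
  weighted (∣ S ∣) (∣ ∁ S ∣) 0
    ≡⟨ trans (weighted-zero (∣ S ∣) _) (sym (weighted-zero (∣ S ∣) _)) ⟩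
  weighted (∣ S ∣) (suc ∣ ∁ S ∣) 0
    ∎
  where open ≡-Reasoning
intersection-weighted {suc n} (false ∷ S) (suc k) = begin
  ∑ (allSubsets (suc n)) (weightIfSize (false ∷ S) (suc k))
    ≡⟨ trans (∑-cube-suc n _) (∑-+ (allSubsets n) _ _) ⟩
  ∑ (allSubsets n) (weightIfSize S (suc k)) + ∑ (allSubsets n) (weightIfSize S k)
    ≡⟨ cong₂ _+_ (intersection-weighted S (suc k)) (intersection-weighted S k) ⟩
  weighted (∣ S ∣) (∣ ∁ S ∣) (suc k) + weighted (∣ S ∣) (∣ ∁ S ∣) k
    ≡⟨ weighted-unmarked (∣ S ∣) (∣ ∁ S ∣) k ⟨
  weighted (∣ S ∣) (suc ∣ ∁ S ∣) (suc k)
    ∎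
  where open ≡-Reasoning

-- Estimating the intersection-weighted count
--
-- With q + t = r + 1 and k ≤ t we have C(r,k-1) ≤ (t/q) C(r,k), so
-- [x^k] (1 + 2x)^s (1 + x)^r ≤ C(r,k) (1 + 2t/q)^s.

weighted-bound : ∀ q t r → q + t ≡ suc r →
                 ∀ s k → k ≤ t → q ^ s * weighted s r k ≤ (r C k) * (q + 2 * t) ^ s
weighted-bound q t r q+t≡1+r zero k k≤t =
  ≤-reflexive (trans (*-identityˡ _) (sym (*-identityʳ _)))
weighted-bound q t r q+t≡1+r (suc s) zero k≤t = begin
  q * q ^ s * weighted s r 0          ≡⟨ *-assoc q (q ^ s) _ ⟩
  q * (q ^ s * weighted s r 0)        ≤⟨ *-mono-≤ (m≤m+n q (2 * t)) (weighted-bound q t r q+t≡1+r s zero k≤t) ⟩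
  (q + 2 * t) * (1 * (q + 2 * t) ^ s) ≡⟨ regroup (q + 2 * t) ((q + 2 * t) ^ s) ⟩
  1 * ((q + 2 * t) * (q + 2 * t) ^ s) ∎
  where open ≤-Reasoning
        regroup : ∀ a b → a * (1 * b) ≡ 1 * (a * b)
        regroup = solve-∀
weighted-bound q t r q+t≡1+r (suc s) (suc k) k<t = begin
  q * q ^ s * (weighted s r (suc k) + 2 * weighted s r k)
    ≡⟨ expand q (q ^ s) (weighted s r (suc k)) (weighted s r k) ⟩
  q * (q ^ s * weighted s r (suc k)) + 2 * q * (q ^ s * weighted s r k)
    ≤⟨ +-mono-≤ (*-monoʳ-≤ q (weighted-bound q t r q+t≡1+r s (suc k) k<t))
                (*-monoʳ-≤ (2 * q) (weighted-bound q t r q+t≡1+r s k (≤-trans (n≤1+n k) k<t))) ⟩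
  q * (C₁ * P) + 2 * q * (C₀ * P)
    ≡⟨ regroup q C₁ C₀ P ⟩
  q * C₁ * P + 2 * (q * C₀) * P
    ≤⟨ +-monoʳ-≤ (q * C₁ * P) (*-monoˡ-≤ P (*-monoʳ-≤ 2 (C-ratio q t r k q+t≡1+r k<t))) ⟩
  q * C₁ * P + 2 * (t * C₁) * P
    ≡⟨ collect q t C₁ P ⟩
  C₁ * ((q + 2 * t) * P)
    ∎
  where open ≤-Reasoning
        C₁ = r C suc k
        C₀ = r C k
        P = (q + 2 * t) ^ s
        expand : ∀ q Q a b → q * Q * (a + 2 * b) ≡ q * (Q * a) + 2 * q * (Q * b)
        expand = solve-∀
        regroup : ∀ q a b P → q * (a * P) + 2 * q * (b * P) ≡ q * a * P + 2 * (q * b) * P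
        regroup = solve-∀
        collect : ∀ q t a P → q * a * P + 2 * (t * a) * P ≡ a * ((q + 2 * t) * P)
        collect = solve-∀

-- Powers of b + w versus powers of b: (1 + w/b)^t ≤ 2^c when t ≤ j c and
-- (1 + w/b)^j ≤ 2, the latter holding as soon as 2 j w ≤ b + w.

-- (b + w)^j ≤ b^j + j w (b + w)^(j-1), multiplied through by b + w.
pow-increment : ∀ b w j → (b + w) ^ j * (b + w) ≤ b ^ j * (b + w) + j * w * (b + w) ^ j
pow-increment b w zero    = ≤-reflexive (sym (+-identityʳ _))
pow-increment b w (suc j) = begin
  (b + w) * (b + w) ^ j * (b + w)     ≡⟨ *-assoc (b + w) _ _ ⟩
  (b + w) * ((b + w) ^ j * (b + w))   ≤⟨ *-monoʳ-≤ (b + w) (pow-increment b w j) ⟩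
  (b + w) * (b ^ j * (b + w) + j * w * (b + w) ^ j)
    ≡⟨ expand b w (b ^ j) j ((b + w) ^ j) ⟩
  b * b ^ j * (b + w) + w * (b ^ j * (b + w)) + j * w * ((b + w) * (b + w) ^ j)
    ≤⟨ +-monoˡ-≤ _ (+-monoʳ-≤ (b * b ^ j * (b + w)) (*-monoʳ-≤ w b^j[b+w]≤[b+w]^[j+1])) ⟩
  b * b ^ j * (b + w) + w * ((b + w) * (b + w) ^ j) + j * w * ((b + w) * (b + w) ^ j)
    ≡⟨ collect (b * b ^ j * (b + w)) w j ((b + w) * (b + w) ^ j) ⟩
  b * b ^ j * (b + w) + suc j * w * ((b + w) * (b + w) ^ j) ∎
  where open ≤-Reasoning
        b^j[b+w]≤[b+w]^[j+1] : b ^ j * (b + w) ≤ (b + w) * (b + w) ^ j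
        b^j[b+w]≤[b+w]^[j+1] = ≤-trans (≤-reflexive (*-comm (b ^ j) (b + w)))
                                       (*-monoʳ-≤ (b + w) (^-monoˡ-≤ j (m≤m+n b w)))
        expand : ∀ b w A j B → (b + w) * (A * (b + w) + j * w * B) ≡
                               b * A * (b + w) + w * (A * (b + w)) + j * w * ((b + w) * B)
        expand = solve-∀
        collect : ∀ X w j Y → X + w * Y + j * w * Y ≡ X + (1 + j) * w * Y
        collect = solve-∀

pow-at-most-double : ∀ a w j → 2 * j * w ≤ suc a + w → (suc a + w) ^ j ≤ 2 * suc a ^ j
pow-at-most-double a w j 2jw≤M = *-cancelʳ-≤ X (2 * Y) M (+-cancelʳ-≤ (X * M) (X * M) (2 * Y * M) (begin
  X * M + X * M             ≡⟨ double (X * M) ⟩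
  2 * (X * M)               ≤⟨ *-monoʳ-≤ 2 (pow-increment (suc a) w j) ⟩
  2 * (Y * M + j * w * X)   ≡⟨ expand Y M j w X ⟩
  2 * Y * M + 2 * j * w * X ≤⟨ +-monoʳ-≤ (2 * Y * M) (*-monoˡ-≤ X 2jw≤M) ⟩
  2 * Y * M + M * X         ≡⟨ cong (2 * Y * M +_) (*-comm M X) ⟩
  2 * Y * M + X * M         ∎))
  where open ≤-Reasoning
        X = (suc a + w) ^ j
        Y = suc a ^ j
        M = suc a + w
        double : ∀ x → x + x ≡ 2 * x
        double = solve-∀
        expand : ∀ Y M j w X → 2 * (Y * M + j * w * X) ≡ 2 * Y * M + 2 * j * w * X
        expand = solve-∀

pow-blocks : ∀ a w j → 2 * j * w ≤ suc a + w → ∀ i → (suc a + w) ^ (j * i) ≤ 2 ^ i * suc a ^ (j * i)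
pow-blocks a w j h zero    rewrite *-zeroʳ j = ≤-refl
pow-blocks a w j h (suc i) rewrite *-suc j i = begin
  (suc a + w) ^ (j + j * i)                  ≡⟨ ^-distribˡ-+-* (suc a + w) j (j * i) ⟩
  (suc a + w) ^ j * (suc a + w) ^ (j * i)    ≤⟨ *-mono-≤ (pow-at-most-double a w j h) (pow-blocks a w j h i) ⟩
  2 * suc a ^ j * (2 ^ i * suc a ^ (j * i))  ≡⟨ swap (suc a ^ j) (2 ^ i) (suc a ^ (j * i)) ⟩
  2 * 2 ^ i * (suc a ^ j * suc a ^ (j * i))  ≡⟨ cong (2 * 2 ^ i *_) (^-distribˡ-+-* (suc a) j (j * i)) ⟨
  2 * 2 ^ i * suc a ^ (j + j * i)            ∎
  where open ≤-Reasoning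
        swap : ∀ A B C → 2 * A * (B * C) ≡ 2 * B * (A * C)
        swap = solve-∀

pow-growth : ∀ a w j c t → 2 * j * w ≤ suc a + w → t ≤ j * c → (suc a + w) ^ t ≤ 2 ^ c * suc a ^ t
pow-growth a w j c t h t≤jc =
  *-cancelʳ-≤ ((suc a + w) ^ t) (2 ^ c * suc a ^ t) (suc a ^ e) {{m^n≢0 (suc a) e}} (begin
    (suc a + w) ^ t * suc a ^ e        ≤⟨ *-monoʳ-≤ ((suc a + w) ^ t) (^-monoˡ-≤ e (m≤m+n (suc a) w)) ⟩
    (suc a + w) ^ t * (suc a + w) ^ e  ≡⟨ ^-distribˡ-+-* (suc a + w) t e ⟨
    (suc a + w) ^ (t + e)              ≡⟨ cong ((suc a + w) ^_) t+e≡jc ⟩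
    (suc a + w) ^ (j * c)              ≤⟨ pow-blocks a w j h c ⟩
    2 ^ c * suc a ^ (j * c)            ≡⟨ cong (λ z → 2 ^ c * suc a ^ z) t+e≡jc ⟨
    2 ^ c * suc a ^ (t + e)            ≡⟨ cong (2 ^ c *_) (^-distribˡ-+-* (suc a) t e) ⟩
    2 ^ c * (suc a ^ t * suc a ^ e)    ≡⟨ *-assoc (2 ^ c) _ _ ⟨
    2 ^ c * suc a ^ t * suc a ^ e      ∎)
  where open ≤-Reasoning
        e = j * c ∸ t
        t+e≡jc : t + e ≡ j * c
        t+e≡jc = m+[n∸m]≡n t≤jc

a+t≤a+2t : ∀ a t {n} → a + 2 * t ≡ n → a + t ≤ n
a+t≤a+2t a t a+2t≡n = ≤-trans (m≤m+n (a + t) t) (≤-reflexive (trans (split a t) a+2t≡n))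
  where split : ∀ a t → a + t + t ≡ a + 2 * t
        split = solve-∀

intersection-bound : ∀ n t a j c (S : Subset n) → ∣ S ∣ ≡ t → a + 2 * t ≡ n →
                     2 * j * (2 * t) ≤ suc a + 2 * t → t ≤ j * c →
                     ∑[ s ∈ subsetsOfSize n t ] 2 ^ ∣ S ∩ s ∣ ≤ 2 ^ c * (n C t)
intersection-bound n t a j c S ∣S∣≡t a+2t≡n h t≤jc =
  *-cancelˡ-≤ (suc a ^ t) {{m^n≢0 (suc a) t}} (begin
    suc a ^ t * (∑[ s ∈ subsetsOfSize n t ] 2 ^ ∣ S ∩ s ∣)
      ≡⟨ cong (suc a ^ t *_) W≡weighted ⟩
    suc a ^ t * weighted t r t
      ≤⟨ weighted-bound (suc a) t r (cong suc (sym r≡a+t)) t t ≤-refl ⟩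
    (r C t) * (suc a + 2 * t) ^ t
      ≤⟨ *-mono-≤ (C-monoˡ r n t r≤n) (pow-growth a (2 * t) j c t h t≤jc) ⟩
    (n C t) * (2 ^ c * suc a ^ t)
      ≡⟨ rotate (n C t) (2 ^ c) (suc a ^ t) ⟩
    suc a ^ t * (2 ^ c * (n C t))
      ∎)
  where open ≤-Reasoning
        r = ∣ ∁ S ∣
        r≡a+t : r ≡ a + t
        r≡a+t = begin-equality
          ∣ ∁ S ∣         ≡⟨ ∣∁p∣≡n∸∣p∣ S ⟩
          n ∸ ∣ S ∣       ≡⟨ cong₂ _∸_ (sym a+2t≡n) ∣S∣≡t ⟩
          a + 2 * t ∸ t   ≡⟨ cong (_∸ t) (split a t) ⟩
          a + t + t ∸ t   ≡⟨ m+n∸n≡m (a + t) t ⟩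
          a + t           ∎
          where split : ∀ a t → a + 2 * t ≡ a + t + t
                split = solve-∀
        r≤n : r ≤ n
        r≤n = ≤-trans (≤-reflexive r≡a+t) (a+t≤a+2t a t a+2t≡n)
        W≡weighted : ∑[ s ∈ subsetsOfSize n t ] 2 ^ ∣ S ∩ s ∣ ≡ weighted t r t
        W≡weighted = trans (∑-filter (λ s → ∣ s ∣ ≟ t) (allSubsets n) _)
                       (trans (intersection-weighted S t) (cong (λ z → weighted z r t) ∣S∣≡t))
        rotate : ∀ B C Q → B * (C * Q) ≡ Q * (C * B)
        rotate = solve-∀

∑ᵢ : {A : Set} {m : ℕ} → (A → ℕ) → Vec A m → ℕ
∑ᵢ g []       = 0
∑ᵢ g (S ∷ Ss) = g S + ∑ᵢ g Ss

∑ᵢ<ⱼ : {A : Set} {m : ℕ} → (A → A → ℕ) → Vec A m → ℕ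
∑ᵢ<ⱼ h []       = 0
∑ᵢ<ⱼ h (S ∷ Ss) = ∑ᵢ (h S) Ss + ∑ᵢ<ⱼ h Ss

module _ {A : Set} (L : List A) where

  ∑-tuples-suc : (m : ℕ) (f : Vec A (suc m) → ℕ) →
                 ∑ (tuples L (suc m)) f ≡ ∑[ S ∈ L ] ∑[ Ss ∈ tuples L m ] f (S ∷ Ss)
  ∑-tuples-suc m f = trans (∑-concatMap _ L f) (∑-cong L (λ S _ → ∑-map (S ∷_) (tuples L m) f))

  tuples-length : (m : ℕ) → length (tuples L m) ≡ length L ^ m
  tuples-length zero    = refl
  tuples-length (suc m) = begin
    length (tuples L (suc m))               ≡⟨ length≡∑1 (tuples L (suc m)) ⟩
    ∑[ _ ∈ tuples L (suc m) ] 1             ≡⟨ ∑-tuples-suc m (λ _ → 1) ⟩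
    ∑[ _ ∈ L ] ∑[ _ ∈ tuples L m ] 1        ≡⟨ ∑-cong L (λ _ _ → sym (length≡∑1 (tuples L m))) ⟩
    ∑[ _ ∈ L ] length (tuples L m)          ≡⟨ ∑-const L _ ⟩
    length L * length (tuples L m)          ≡⟨ cong (length L *_) (tuples-length m) ⟩
    length L ^ suc m                        ∎
    where open ≡-Reasoning

  ∑-tuples-const : (m k : ℕ) → ∑[ _ ∈ tuples L m ] k ≡ length L ^ m * k
  ∑-tuples-const m k = trans (∑-const (tuples L m) k) (cong (_* k) (tuples-length m))

  ∑-tuples-split : (m : ℕ) (Φ : Vec A (suc m) → ℕ) (φ : A → Vec A m → ℕ) (F : Vec A m → ℕ) →
                   (∀ S Ss → Φ (S ∷ Ss) ≡ φ S Ss + F Ss) →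
                   ∑ (tuples L (suc m)) Φ ≡ ∑[ S ∈ L ] ∑ (tuples L m) (φ S) + length L * ∑ (tuples L m) F
  ∑-tuples-split m Φ φ F Φ≡ = begin
    ∑ (tuples L (suc m)) Φ
      ≡⟨ ∑-tuples-suc m Φ ⟩
    ∑[ S ∈ L ] ∑[ Ss ∈ tuples L m ] Φ (S ∷ Ss)
      ≡⟨ ∑-cong L (λ S _ → trans (∑-cong (tuples L m) (λ Ss _ → Φ≡ S Ss)) (∑-+ (tuples L m) (φ S) F)) ⟩
    ∑[ S ∈ L ] (∑ (tuples L m) (φ S) + ∑ (tuples L m) F)
      ≡⟨ ∑-+ L _ _ ⟩
    ∑[ S ∈ L ] ∑ (tuples L m) (φ S) + ∑[ _ ∈ L ] ∑ (tuples L m) F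
      ≡⟨ cong (∑[ S ∈ L ] ∑ (tuples L m) (φ S) +_) (∑-const L _) ⟩
    ∑[ S ∈ L ] ∑ (tuples L m) (φ S) + length L * ∑ (tuples L m) F
      ∎
    where open ≡-Reasoning

  -- Linearity of expectation: E[Σ_i g(S_i)] = m · E[g(S)], cleared of denominators.
  ∑-tuples-∑ᵢ : (g : A → ℕ) (m : ℕ) → length L * ∑ (tuples L m) (∑ᵢ g) ≡ m * length L ^ m * ∑ L g
  ∑-tuples-∑ᵢ g zero    = *-zeroʳ (length L)
  ∑-tuples-∑ᵢ g (suc m) = begin
    N * ∑ (tuples L (suc m)) (∑ᵢ g)
      ≡⟨ cong (N *_) (∑-tuples-split m (∑ᵢ g) (λ S _ → g S) (∑ᵢ g) (λ _ _ → refl)) ⟩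
    N * (∑[ S ∈ L ] ∑[ _ ∈ tuples L m ] g S + N * ∑ (tuples L m) (∑ᵢ g))
      ≡⟨ cong (λ z → N * (z + N * ∑ (tuples L m) (∑ᵢ g)))
              (trans (∑-cong L (λ S _ → ∑-tuples-const m (g S))) (∑-*ˡ L (N ^ m) g)) ⟩
    N * (N ^ m * ∑ L g + N * ∑ (tuples L m) (∑ᵢ g))
      ≡⟨ cong (λ z → N * (N ^ m * ∑ L g + z)) (∑-tuples-∑ᵢ g m) ⟩
    N * (N ^ m * ∑ L g + m * N ^ m * ∑ L g)
      ≡⟨ collect N (N ^ m) (∑ L g) m ⟩
    suc m * (N * N ^ m) * ∑ L g
      ∎
    where open ≡-Reasoning
          N = length L
          collect : ∀ N Nm G m → N * (Nm * G + m * Nm * G) ≡ suc m * (N * Nm) * G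
          collect = solve-∀

  -- E[Σ_{i<j} h(S_i,S_j)] ≤ C(m,2) · max_S E_{S'} h(S,S'), cleared of denominators:
  -- if X · Σ_{S'} h(S,S') ≤ Y for every S ∈ L then N · 2Σ · X ≤ m² N^m Y.
  ∑-tuples-∑ᵢ<ⱼ : (h : A → A → ℕ) (X Y : ℕ) → (∀ S → S ∈ L → ∑ L (h S) * X ≤ Y) →
                  (m : ℕ) → length L * (2 * ∑ (tuples L m) (∑ᵢ<ⱼ h)) * X ≤ m * m * length L ^ m * Y
  ∑-tuples-∑ᵢ<ⱼ h X Y hX≤Y zero    rewrite *-zeroʳ (length L) = z≤n
  ∑-tuples-∑ᵢ<ⱼ h X Y hX≤Y (suc m) = begin
    N * (2 * ∑ (tuples L (suc m)) (∑ᵢ<ⱼ h)) * X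
      ≡⟨ cong (λ z → N * (2 * z) * X) (∑-tuples-split m (∑ᵢ<ⱼ h) (λ S → ∑ᵢ (h S)) (∑ᵢ<ⱼ h) (λ _ _ → refl)) ⟩
    N * (2 * (∑ L F + N * E)) * X
      ≡⟨ expand N (∑ L F) E X ⟩
    2 * (N * X * ∑ L F) + N * (N * (2 * E) * X)
      ≡⟨ cong (λ z → 2 * z + N * (N * (2 * E) * X)) (∑-*ˡ L (N * X) F) ⟨
    2 * (∑[ S ∈ L ] (N * X * F S)) + N * (N * (2 * E) * X)
      ≤⟨ +-mono-≤ (*-monoʳ-≤ 2 (∑-mono L first)) (*-monoʳ-≤ N (∑-tuples-∑ᵢ<ⱼ h X Y hX≤Y m)) ⟩
    2 * (∑[ _ ∈ L ] (m * N ^ m * Y)) + N * (m * m * N ^ m * Y)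
      ≡⟨ cong (λ z → 2 * z + N * (m * m * N ^ m * Y)) (∑-const L _) ⟩
    2 * (N * (m * N ^ m * Y)) + N * (m * m * N ^ m * Y)
      ≤⟨ m≤n+m _ (N * N ^ m * Y) ⟩
    N * N ^ m * Y + (2 * (N * (m * N ^ m * Y)) + N * (m * m * N ^ m * Y))
      ≡⟨ collect N (N ^ m) Y m ⟩
    suc m * suc m * (N * N ^ m) * Y
      ∎
    where open ≤-Reasoning
          N = length L
          E = ∑ (tuples L m) (∑ᵢ<ⱼ h)
          F : A → ℕ
          F S = ∑ (tuples L m) (∑ᵢ (h S))
          first : ∀ S → S ∈ L → N * X * F S ≤ m * N ^ m * Y
          first S S∈L = begin
            N * X * F S                 ≡⟨ swap N X (F S) ⟩
            N * F S * X                 ≡⟨ cong (_* X) (∑-tuples-∑ᵢ (h S) m) ⟩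
            m * N ^ m * ∑ L (h S) * X   ≡⟨ *-assoc (m * N ^ m) _ X ⟩
            m * N ^ m * (∑ L (h S) * X) ≤⟨ *-monoʳ-≤ (m * N ^ m) (hX≤Y S S∈L) ⟩
            m * N ^ m * Y               ∎
            where swap : ∀ N X W → N * X * W ≡ N * W * X
                  swap = solve-∀
          expand : ∀ N a b X → N * (2 * (a + N * b)) * X ≡ 2 * (N * X * a) + N * (N * (2 * b) * X)
          expand = solve-∀
          collect : ∀ N Nm Y m → N * Nm * Y + (2 * (N * (m * Nm * Y)) + N * (m * m * Nm * Y)) ≡
                                 suc m * suc m * (N * Nm) * Y
          collect = solve-∀

coveredPairs : {n m : ℕ} → Vec (Subset n) m → Subset n → ℕ
coveredPairs []       x = 0
coveredPairs (S ∷ Ss) x = covers S x * countT Ss x + coveredPairs Ss x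

∑-countT : {n m : ℕ} (Ss : Vec (Subset n) m) →
           ∑ (allSubsets n) (countT Ss) ≡ ∑ᵢ (λ S → ∑ (allSubsets n) (covers S)) Ss
∑-countT {n} []       = ∑-zero (allSubsets n)
∑-countT {n} (S ∷ Ss) = trans (∑-+ (allSubsets n) (covers S) (countT Ss)) (cong (_ +_) (∑-countT Ss))

∑-covers*countT : {n m : ℕ} (S : Subset n) (Ss : Vec (Subset n) m) →
                  ∑[ x ∈ allSubsets n ] (covers S x * countT Ss x) ≡ ∑ᵢ (jointCover S) Ss
∑-covers*countT {n} S [] =
  trans (∑-cong (allSubsets n) (λ x _ → *-zeroʳ (covers S x))) (∑-zero (allSubsets n))
∑-covers*countT {n} S (S' ∷ Ss) = begin
  ∑[ x ∈ allSubsets n ] (covers S x * (covers S' x + countT Ss x))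
    ≡⟨ ∑-cong (allSubsets n) (λ x _ → *-distribˡ-+ (covers S x) (covers S' x) (countT Ss x)) ⟩
  ∑[ x ∈ allSubsets n ] (covers S x * covers S' x + covers S x * countT Ss x)
    ≡⟨ ∑-+ (allSubsets n) _ _ ⟩
  jointCover S S' + ∑[ x ∈ allSubsets n ] (covers S x * countT Ss x)
    ≡⟨ cong (jointCover S S' +_) (∑-covers*countT S Ss) ⟩
  jointCover S S' + ∑ᵢ (jointCover S) Ss
    ∎
  where open ≡-Reasoning

∑-coveredPairs : {n m : ℕ} (Ss : Vec (Subset n) m) → ∑ (allSubsets n) (coveredPairs Ss) ≡ ∑ᵢ<ⱼ jointCover Ss
∑-coveredPairs {n} []       = ∑-zero (allSubsets n)
∑-coveredPairs {n} (S ∷ Ss) =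
  trans (∑-+ (allSubsets n) _ (coveredPairs Ss))
        (cong₂ _+_ (∑-covers*countT S Ss) (∑-coveredPairs Ss))

-- If T ≥ 2 then T ≤ 1 + P, since the first covering set pairs with the other T - 1.
countT≤1+coveredPairs : {n m : ℕ} (Ss : Vec (Subset n) m) (x : Subset n) → countT Ss x ≤ suc (coveredPairs Ss x)
countT≤1+coveredPairs []       x = z≤n
countT≤1+coveredPairs (S ∷ Ss) x with does (S ⊆? x)
... | true  = s≤s (≤-trans (≤-reflexive (sym (+-identityʳ (countT Ss x)))) (m≤m+n _ (coveredPairs Ss x)))
... | false = countT≤1+coveredPairs Ss x

-- The pointwise form of the second-moment method: T ≤ [T = 1] + 2P.
countT≤unique+2pairs : {n m : ℕ} (Ss : Vec (Subset n) m) (x : Subset n) →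
                       countT Ss x ≤ (if does (countT Ss x ≟ 1) then 1 else 0) + 2 * coveredPairs Ss x
countT≤unique+2pairs Ss x = bound (countT Ss x) (coveredPairs Ss x) (countT≤1+coveredPairs Ss x)
  where
  bound : ∀ T P → T ≤ suc P → T ≤ (if does (T ≟ 1) then 1 else 0) + 2 * P
  bound zero                P _         = z≤n
  bound (suc zero)          P _         = s≤s z≤n
  bound (suc (suc T)) P (s≤s T+1≤P) =
    ≤-trans (s≤s (m≤n+m (suc T) T)) (≤-trans (+-mono-≤ T+1≤P T+1≤P) (≤-reflexive (cong (P +_) (sym (+-identityʳ P)))))

-- The second-moment method in counting form
--
-- Read Z/τ as the first moment E[T] and U as the number of outcomes with
-- T = 1 (everything scaled by the number of outcomes).  If
-- E[T] ≤ Pr[T = 1] + 2E[P] and 2E[P] ≤ (m K/τ) E[T] with 2Km ≤ τ, then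
-- Pr[T = 1] ≥ E[T]/2.
second-moment-method : ∀ τ Z m K Δ U E₁ E₂ → 0 < τ →
                       E₁ * τ ≡ Z → 2 * E₂ * (τ * τ) ≤ m * K * Z → E₁ ≤ U + 2 * E₂ →
                       Δ * m ≤ τ → 2 * K ≤ Δ → Z ≤ 2 * τ * U
second-moment-method τ Z m K Δ U E₁ E₂ τ>0 E₁τ≡Z E₂-bound E₁≤U+2E₂ Δm≤τ 2K≤Δ =
  *-cancelˡ-≤ τ {{>-nonZero τ>0}} (+-cancelʳ-≤ (τ * Z) (τ * Z) _ (begin
    τ * Z + τ * Z                   ≡⟨ double (τ * Z) ⟩
    2 * (τ * Z)                     ≤⟨ *-monoʳ-≤ 2 τZ-bound ⟩
    2 * (τ * τ * U + m * K * Z)     ≡⟨ expand τ U m K Z ⟩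
    τ * (2 * τ * U) + 2 * K * m * Z ≤⟨ +-monoʳ-≤ (τ * (2 * τ * U)) (*-monoˡ-≤ Z 2Km≤τ) ⟩
    τ * (2 * τ * U) + τ * Z         ∎))
  where
  open ≤-Reasoning
  2Km≤τ : 2 * K * m ≤ τ
  2Km≤τ = ≤-trans (*-monoˡ-≤ m 2K≤Δ) Δm≤τ
  τZ-bound : τ * Z ≤ τ * τ * U + m * K * Z
  τZ-bound = begin
    τ * Z                          ≡⟨ cong (τ *_) E₁τ≡Z ⟨
    τ * (E₁ * τ)                   ≡⟨ swap τ E₁ ⟩
    E₁ * (τ * τ)                   ≤⟨ *-monoˡ-≤ (τ * τ) E₁≤U+2E₂ ⟩
    (U + 2 * E₂) * (τ * τ)         ≡⟨ distrib U (2 * E₂) (τ * τ) ⟩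
    τ * τ * U + 2 * E₂ * (τ * τ)   ≤⟨ +-monoʳ-≤ (τ * τ * U) E₂-bound ⟩
    τ * τ * U + m * K * Z          ∎
    where swap : ∀ τ E → τ * (E * τ) ≡ E * (τ * τ)
          swap = solve-∀
          distrib : ∀ U V W → (U + V) * W ≡ W * U + V * W
          distrib = solve-∀
  double : ∀ x → x + x ≡ 2 * x
  double = solve-∀
  expand : ∀ τ U m K Z → 2 * (τ * τ * U + m * K * Z) ≡ τ * (2 * τ * U) + 2 * K * m * Z
  expand = solve-∀

∑-outcomes : (n t m : ℕ) (f : Outcome n m → ℕ) →
             ∑ (outcomes n t m) f ≡ ∑[ Ss ∈ tuples (subsetsOfSize n t) m ] ∑[ x ∈ allSubsets n ] f ⟨ Ss , x ⟩
∑-outcomes n t m f = trans (∑-concatMap _ (tuples (subsetsOfSize n t) m) f)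
  (∑-cong (tuples (subsetsOfSize n t) m) (λ Ss _ → ∑-map (λ x → ⟨ Ss , x ⟩) (allSubsets n) f))

isUnique : {n m : ℕ} → Vec (Subset n) m → Subset n → ℕ
isUnique Ss x = if does (countT Ss x ≟ 1) then 1 else 0

favourable-as-sum : (n t m : ℕ) →
                    favourable n t m ≡ ∑[ Ss ∈ tuples (subsetsOfSize n t) m ] ∑ (allSubsets n) (isUnique Ss)
favourable-as-sum n t m = begin
  favourable n t m                        ≡⟨ length≡∑1 (filter unique? (outcomes n t m)) ⟩
  ∑[ _ ∈ filter unique? (outcomes n t m) ] 1 ≡⟨ ∑-filter unique? (outcomes n t m) (λ _ → 1) ⟩
  ∑ (outcomes n t m) (λ o → isUnique (Outcome.sys o) (Outcome.pt o))
    ≡⟨ ∑-outcomes n t m _ ⟩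
  ∑[ Ss ∈ tuples (subsetsOfSize n t) m ] ∑ (allSubsets n) (isUnique Ss) ∎
  where open ≡-Reasoning
        unique? = λ (o : Outcome n m) → countT (Outcome.sys o) (Outcome.pt o) ≟ 1

total-as-product : (n t m : ℕ) → total n t m ≡ (n C t) ^ m * 2 ^ n
total-as-product n t m = begin
  total n t m                                                 ≡⟨ length≡∑1 (outcomes n t m) ⟩
  ∑[ _ ∈ outcomes n t m ] 1                                   ≡⟨ ∑-outcomes n t m _ ⟩
  ∑[ _ ∈ tuples (subsetsOfSize n t) m ] ∑[ _ ∈ allSubsets n ] 1
    ≡⟨ ∑-cong (tuples (subsetsOfSize n t) m) (λ _ _ → trans (sym (length≡∑1 (allSubsets n))) (cube-size n)) ⟩
  ∑[ _ ∈ tuples (subsetsOfSize n t) m ] 2 ^ n                 ≡⟨ ∑-tuples-const (subsetsOfSize n t) m (2 ^ n) ⟩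
  length (subsetsOfSize n t) ^ m * 2 ^ n                      ≡⟨ cong (λ N → N ^ m * 2 ^ n) (subsetsOfSize-length n t) ⟩
  (n C t) ^ m * 2 ^ n                                         ∎
  where open ≡-Reasoning

module OutcomeSums (n t m : ℕ) where

  𝓛 : List (Subset n)
  𝓛 = subsetsOfSize n t

  N : ℕ
  N = length 𝓛

  τ : ℕ
  τ = 2 ^ t

  U : ℕ
  U = ∑[ Ss ∈ tuples 𝓛 m ] ∑ (allSubsets n) (isUnique Ss)

  E₁ : ℕ
  E₁ = ∑[ Ss ∈ tuples 𝓛 m ] ∑ (allSubsets n) (countT Ss)

  E₂ : ℕ
  E₂ = ∑[ Ss ∈ tuples 𝓛 m ] ∑ (allSubsets n) (coveredPairs Ss)

  N>0 : t ≤ n → 0 < N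
  N>0 t≤n = subst (0 <_) (sym (subsetsOfSize-length n t)) (C-pos n t t≤n)

  ∣S∣≡t : ∀ S → S ∈ 𝓛 → ∣ S ∣ ≡ t
  ∣S∣≡t S S∈𝓛 = proj₂ (∈-filter⁻ (λ s → ∣ s ∣ ≟ t) {xs = allSubsets n} S∈𝓛)

  -- E[T] = m 2^-t.
  first-moment : t ≤ n → E₁ * τ ≡ m * N ^ m * 2 ^ n
  first-moment t≤n = *-cancelˡ-≡ (E₁ * τ) _ N {{>-nonZero (N>0 t≤n)}} (begin
    N * (E₁ * τ)                     ≡⟨ *-assoc N E₁ τ ⟨
    N * E₁ * τ                       ≡⟨ cong (λ e → N * e * τ) (∑-cong (tuples 𝓛 m) (λ Ss _ → ∑-countT Ss)) ⟩
    N * ∑ (tuples 𝓛 m) (∑ᵢ A) * τ    ≡⟨ cong (_* τ) (∑-tuples-∑ᵢ 𝓛 A m) ⟩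
    m * N ^ m * ∑ 𝓛 A * τ            ≡⟨ *-assoc (m * N ^ m) (∑ 𝓛 A) τ ⟩
    m * N ^ m * (∑ 𝓛 A * τ)          ≡⟨ cong (m * N ^ m *_) ∑A*τ≡N*2ⁿ ⟩
    m * N ^ m * (N * 2 ^ n)          ≡⟨ swap m (N ^ m) N (2 ^ n) ⟩
    N * (m * N ^ m * 2 ^ n)          ∎)
    where
    open ≡-Reasoning
    A : Subset n → ℕ
    A S = ∑ (allSubsets n) (covers S)
    ∑A*τ≡N*2ⁿ : ∑ 𝓛 A * τ ≡ N * 2 ^ n
    ∑A*τ≡N*2ⁿ = begin
      ∑ 𝓛 A * τ              ≡⟨ *-comm (∑ 𝓛 A) τ ⟩
      τ * ∑ 𝓛 A              ≡⟨ ∑-*ˡ 𝓛 τ A ⟨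
      ∑[ S ∈ 𝓛 ] (τ * A S)   ≡⟨ ∑-cong 𝓛 (λ S S∈𝓛 → trans (*-comm τ (A S))
                                  (trans (cong (λ k → A S * 2 ^ k) (sym (∣S∣≡t S S∈𝓛))) (covers-count S))) ⟩
      ∑[ _ ∈ 𝓛 ] 2 ^ n       ≡⟨ ∑-const 𝓛 (2 ^ n) ⟩
      N * 2 ^ n              ∎
    swap : ∀ m Nm N P → m * Nm * (N * P) ≡ N * (m * Nm * P)
    swap = solve-∀

  -- For n = a + 2t and the hypotheses of intersection-bound:
  -- E_{S'}[Pr_x(S ∪ S' ⊆ x)] ≤ 2^c 2^-2t for each S.
  joint-bound : ∀ a j c → a + 2 * t ≡ n → 2 * j * (2 * t) ≤ suc a + 2 * t → t ≤ j * c →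
                ∀ S → S ∈ 𝓛 → ∑ 𝓛 (jointCover S) * (τ * τ) ≤ 2 ^ n * (2 ^ c * N)
  joint-bound a j c a+2t≡n hj t≤jc S S∈𝓛 = begin
    ∑ 𝓛 (jointCover S) * (τ * τ)             ≡⟨ *-comm (∑ 𝓛 (jointCover S)) (τ * τ) ⟩
    τ * τ * ∑ 𝓛 (jointCover S)               ≡⟨ ∑-*ˡ 𝓛 (τ * τ) (jointCover S) ⟨
    ∑[ S' ∈ 𝓛 ] (τ * τ * jointCover S S')    ≡⟨ ∑-cong 𝓛 exact ⟩
    ∑[ S' ∈ 𝓛 ] (2 ^ n * 2 ^ ∣ S ∩ S' ∣)     ≡⟨ ∑-*ˡ 𝓛 (2 ^ n) (λ S' → 2 ^ ∣ S ∩ S' ∣) ⟩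
    2 ^ n * (∑[ S' ∈ 𝓛 ] 2 ^ ∣ S ∩ S' ∣)     ≤⟨ *-monoʳ-≤ (2 ^ n) (intersection-bound n t a j c S (∣S∣≡t S S∈𝓛) a+2t≡n hj t≤jc) ⟩
    2 ^ n * (2 ^ c * (n C t))                ≡⟨ cong (λ z → 2 ^ n * (2 ^ c * z)) (sym (subsetsOfSize-length n t)) ⟩
    2 ^ n * (2 ^ c * N)                      ∎
    where
    open ≤-Reasoning
    exact : ∀ S' → S' ∈ 𝓛 → τ * τ * jointCover S S' ≡ 2 ^ n * 2 ^ ∣ S ∩ S' ∣
    exact S' S'∈𝓛 = begin-equality
      τ * τ * jointCover S S'                ≡⟨ *-comm (τ * τ) _ ⟩
      jointCover S S' * (τ * τ)              ≡⟨ cong (jointCover S S' *_) (^-distribˡ-+-* 2 t t) ⟨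
      jointCover S S' * 2 ^ (t + t)          ≡⟨ cong₂ (λ u v → jointCover S S' * 2 ^ (u + v)) (∣S∣≡t S S∈𝓛) (∣S∣≡t S' S'∈𝓛) ⟨
      jointCover S S' * 2 ^ (∣ S ∣ + ∣ S' ∣) ≡⟨ jointCover-exact S S' ⟩
      2 ^ n * 2 ^ ∣ S ∩ S' ∣                 ∎

  -- 2E[P] ≤ m² 2^c 2^-2t, i.e. at most (m 2^c / 2^t) E[T].
  second-moment : ∀ a j c → a + 2 * t ≡ n → 2 * j * (2 * t) ≤ suc a + 2 * t → t ≤ j * c →
                  2 * E₂ * (τ * τ) ≤ m * 2 ^ c * (m * N ^ m * 2 ^ n)
  second-moment a j c a+2t≡n hj t≤jc = *-cancelˡ-≤ N {{>-nonZero (N>0 t≤n)}} (begin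
    N * (2 * E₂ * (τ * τ))
      ≡⟨ cong (λ e → N * (2 * e * (τ * τ))) (∑-cong (tuples 𝓛 m) (λ Ss _ → ∑-coveredPairs Ss)) ⟩
    N * (2 * ∑ (tuples 𝓛 m) (∑ᵢ<ⱼ jointCover) * (τ * τ))
      ≡⟨ *-assoc N (2 * ∑ (tuples 𝓛 m) (∑ᵢ<ⱼ jointCover)) (τ * τ) ⟨
    N * (2 * ∑ (tuples 𝓛 m) (∑ᵢ<ⱼ jointCover)) * (τ * τ)
      ≤⟨ ∑-tuples-∑ᵢ<ⱼ 𝓛 jointCover (τ * τ) (2 ^ n * (2 ^ c * N)) (joint-bound a j c a+2t≡n hj t≤jc) m ⟩
    m * m * N ^ m * (2 ^ n * (2 ^ c * N))
      ≡⟨ regroup m (N ^ m) (2 ^ n) (2 ^ c) N ⟩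
    N * (m * 2 ^ c * (m * N ^ m * 2 ^ n))
      ∎)
    where
    open ≤-Reasoning
    t≤n : t ≤ n
    t≤n = ≤-trans (m≤n+m t a) (a+t≤a+2t a t a+2t≡n)
    regroup : ∀ m Nm P K N → m * m * Nm * (P * (K * N)) ≡ N * (m * K * (m * Nm * P))
    regroup = solve-∀

  pointwise : E₁ ≤ U + 2 * E₂
  pointwise = begin
    E₁
      ≤⟨ ∑-mono (tuples 𝓛 m) (λ Ss _ → ∑-mono (allSubsets n) (λ x _ → countT≤unique+2pairs Ss x)) ⟩
    ∑[ Ss ∈ tuples 𝓛 m ] ∑[ x ∈ allSubsets n ] (isUnique Ss x + 2 * coveredPairs Ss x)
      ≡⟨ ∑-cong (tuples 𝓛 m) (λ Ss _ → trans (∑-+ (allSubsets n) (isUnique Ss) _)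
                                           (cong (∑ (allSubsets n) (isUnique Ss) +_) (∑-*ˡ (allSubsets n) 2 (coveredPairs Ss)))) ⟩
    ∑[ Ss ∈ tuples 𝓛 m ] (∑ (allSubsets n) (isUnique Ss) + 2 * ∑ (allSubsets n) (coveredPairs Ss))
      ≡⟨ trans (∑-+ (tuples 𝓛 m) _ _) (cong (U +_) (∑-*ˡ (tuples 𝓛 m) 2 _)) ⟩
    U + 2 * E₂
      ∎
    where open ≤-Reasoning

  total≡N^m2ⁿ : total n t m ≡ N ^ m * 2 ^ n
  total≡N^m2ⁿ = trans (total-as-product n t m) (cong (λ z → z ^ m * 2 ^ n) (sym (subsetsOfSize-length n t)))

unique-cover-count : ∀ n t m a j c Δ Q → a + 2 * t ≡ n →
                     2 * j * (2 * t) ≤ suc a + 2 * t → t ≤ j * c →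
                     Δ * m ≤ 2 ^ t → 2 * 2 ^ c ≤ Δ → 2 ^ t ≤ Q * m →
                     total n t m ≤ 2 * Q * favourable n t m
unique-cover-count n t m a j c Δ Q a+2t≡n hj t≤jc Δm≤τ 2K≤Δ τ≤Qm =
  subst₂ (λ u v → u ≤ 2 * Q * v) (sym total≡N^m2ⁿ) (sym (favourable-as-sum n t m))
    (*-cancelˡ-≤ τ {{m^n≢0 2 t}} (begin
      τ * (N ^ m * 2 ^ n)       ≤⟨ *-monoˡ-≤ (N ^ m * 2 ^ n) τ≤Qm ⟩
      Q * m * (N ^ m * 2 ^ n)   ≡⟨ regroup Q m (N ^ m) (2 ^ n) ⟩
      Q * (m * N ^ m * 2 ^ n)   ≤⟨ *-monoʳ-≤ Q E[T]≤2Pr[T=1] ⟩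
      Q * (2 * τ * U)           ≡⟨ swap Q τ U ⟩
      τ * (2 * Q * U)           ∎))
  where
  open OutcomeSums n t m
  open ≤-Reasoning
  E[T]≤2Pr[T=1] : m * N ^ m * 2 ^ n ≤ 2 * τ * U
  E[T]≤2Pr[T=1] = second-moment-method τ (m * N ^ m * 2 ^ n) m (2 ^ c) Δ U E₁ E₂ (m^n>0 2 t)
    (first-moment (≤-trans (m≤n+m t a) (a+t≤a+2t a t a+2t≡n)))
    (second-moment a j c a+2t≡n hj t≤jc) pointwise Δm≤τ 2K≤Δ
  regroup : ∀ Q m Nm P → Q * m * (Nm * P) ≡ Q * (m * Nm * P)
  regroup = solve-∀
  swap : ∀ Q τ U → Q * (2 * τ * U) ≡ τ * (2 * Q * U)
  swap = solve-∀

-- Choosing the parameters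
--
-- From t² ≤ B d and 64 B ≤ d we get 8t ≤ d, so n = d - 1 = a + 2t; with
-- c = 8B and j = ⌊t / c⌋ + 1 (so t ≤ j c ≤ t + c) the hypothesis
-- 2j·2t ≤ d of pow-at-most-double holds.

square-cancel-≤ : ∀ x y → x * x ≤ y * y → x ≤ y
square-cancel-≤ x y x²≤y² with x ≤? y
... | yes x≤y = x≤y
... | no  x≰y = ⊥-elim (<⇒≱ (*-mono-< (≰⇒> x≰y) (≰⇒> x≰y)) x²≤y²)

round-up : ∀ c .{{_ : NonZero c}} t → t ≤ suc (t / c) * c × suc (t / c) * c ≤ t + c
round-up c t = t≤ , ≤t+c
  where
  t≤ : t ≤ suc (t / c) * c
  t≤ = begin
    t                   ≡⟨ m≡m%n+[m/n]*n t c ⟩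
    t % c + t / c * c   ≤⟨ +-monoˡ-≤ (t / c * c) (<⇒≤ (m%n<n t c)) ⟩
    c + t / c * c       ∎
    where open ≤-Reasoning
  ≤t+c : suc (t / c) * c ≤ t + c
  ≤t+c = ≤-trans (+-monoʳ-≤ c (m/n*n≤m t c)) (≤-reflexive (+-comm c t))

parameters : ∀ B n t → 1 ≤ B → 64 * B ≤ suc n → 1 ≤ t → t * t ≤ B * suc n →
             Σ ℕ λ a → Σ ℕ λ j → (a + 2 * t ≡ n) × (2 * j * (2 * t) ≤ suc a + 2 * t) × (t ≤ j * (8 * B))
parameters B n t B≥1 64B≤d t≥1 t²≤Bd = a , j , a+2t≡n , 2j2t≤d , proj₁ (round-up c t)
  where
  open ≤-Reasoning
  d = suc n
  c = 8 * B
  instance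
    c≢0 : NonZero c
    c≢0 = >-nonZero (≤-trans B≥1 (m≤n*m B 8))
  8t≤d : 8 * t ≤ d
  8t≤d = square-cancel-≤ (8 * t) d (begin
    8 * t * (8 * t)   ≡⟨ square t ⟩
    64 * (t * t)      ≤⟨ *-monoʳ-≤ 64 t²≤Bd ⟩
    64 * (B * d)      ≡⟨ *-assoc 64 B d ⟨
    64 * B * d        ≤⟨ *-monoˡ-≤ d 64B≤d ⟩
    d * d             ∎)
    where square : ∀ t → 8 * t * (8 * t) ≡ 64 * (t * t)
          square = solve-∀
  2t≤n : 2 * t ≤ n
  2t≤n = ≤-pred (≤-trans (+-monoˡ-≤ (2 * t) t≥1) (≤-trans (*-monoˡ-≤ t {3} {8} (s≤s (s≤s (s≤s z≤n)))) 8t≤d))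
  a = n ∸ 2 * t
  a+2t≡n : a + 2 * t ≡ n
  a+2t≡n = m∸n+n≡m 2t≤n
  j = suc (t / c)
  2j2t≤d : 2 * j * (2 * t) ≤ suc a + 2 * t
  2j2t≤d = *-cancelˡ-≤ c (begin
    c * (2 * j * (2 * t))             ≡⟨ regroup B j t ⟩
    4 * t * (j * c)                   ≤⟨ *-monoʳ-≤ (4 * t) (proj₂ (round-up c t)) ⟩
    4 * t * (t + c)                   ≡⟨ expand t B ⟩
    4 * (t * t) + 4 * B * (8 * t)     ≤⟨ +-mono-≤ (*-monoʳ-≤ 4 t²≤Bd) (*-monoʳ-≤ (4 * B) 8t≤d) ⟩
    4 * (B * d) + 4 * B * d           ≡⟨ collect B d ⟩
    c * d                             ≡⟨ cong (λ z → c * suc z) a+2t≡n ⟨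
    c * (suc a + 2 * t)               ∎)
    where regroup : ∀ B j t → 8 * B * (2 * j * (2 * t)) ≡ 4 * t * (j * (8 * B))
          regroup = solve-∀
          expand : ∀ t B → 4 * t * (t + 8 * B) ≡ 4 * (t * t) + 4 * B * (8 * t)
          expand = solve-∀
          collect : ∀ B d → 4 * (B * d) + 4 * B * d ≡ 8 * B * d
          collect = solve-∀

fromℕ : ℕ → ℚ
fromℕ n = mkℚ (ℤ.+ n) 0 (Coprime.sym (Coprime.1-coprimeTo n))

ℕ→ℚ≡fromℕ : ∀ n → ℕ→ℚ n ≡ fromℕ n
ℕ→ℚ≡fromℕ n = ℚP.normalize-coprime (Coprime.sym (Coprime.1-coprimeTo n))

fromℕ-* : ∀ x y → fromℕ (x * y) ≡ fromℕ x ℚ.* fromℕ y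
fromℕ-* x y = trans (sym (ℕ→ℚ≡fromℕ (x * y))) (cong (ℚ._/ 1) (ℤP.pos-* x y))

fromℕ-cancel-≤ : ∀ {x y} → fromℕ x ℚ.≤ fromℕ y → x ≤ y
fromℕ-cancel-≤ {x} {y} (*≤* h) =
  ℤP.drop‿+≤+ (subst₂ ℤ._≤_ (ℤP.*-identityʳ (ℤ.+ x)) (ℤP.*-identityʳ (ℤ.+ y)) h)

natAbove : ℚ → ℕ
natAbove (mkℚ (ℤ.+ k)     _ _) = suc k
natAbove (mkℚ ℤ.-[1+ _ ]  _ _) = 1

natAbove-pos : ∀ p → 1 ≤ natAbove p
natAbove-pos (mkℚ (ℤ.+ _)    _ _) = s≤s z≤n
natAbove-pos (mkℚ ℤ.-[1+ _ ] _ _) = s≤s z≤n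

natAbove-≥ : ∀ p → p ℚ.≤ fromℕ (natAbove p)
natAbove-≥ (mkℚ (ℤ.+ k) d-1 _) = *≤* (subst₂ ℤ._≤_ (ℤP.pos-* k 1) (ℤP.pos-* (suc k) (suc d-1))
  (ℤ.+≤+ (≤-trans (≤-reflexive (*-identityʳ k)) (≤-trans (n≤1+n k) (m≤m*n (suc k) (suc d-1))))))
natAbove-≥ (mkℚ ℤ.-[1+ k ] d-1 _) = *≤* ℤ.-≤+

scaled-≤ : ∀ r x y → ℕ→ℚ x ℚ.≤ r ℚ.* ℕ→ℚ y → x ≤ natAbove r * y
scaled-≤ r x y h = fromℕ-cancel-≤ (begin
  fromℕ x                       ≡⟨ ℕ→ℚ≡fromℕ x ⟨
  ℕ→ℚ x                         ≤⟨ h ⟩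
  r ℚ.* ℕ→ℚ y                   ≡⟨ cong (r ℚ.*_) (ℕ→ℚ≡fromℕ y) ⟩
  r ℚ.* fromℕ y                 ≤⟨ ℚP.*-monoʳ-≤-nonNeg (fromℕ y) (natAbove-≥ r) ⟩
  fromℕ (natAbove r) ℚ.* fromℕ y ≡⟨ fromℕ-* (natAbove r) y ⟨
  fromℕ (natAbove r * y)         ∎)
  where open ℚP.≤-Reasoning

divided-≤ : ∀ Δ x y → ℕ→ℚ x ℚ.≤ 1/ fromℕ (suc Δ) ℚ.* ℕ→ℚ y → suc Δ * x ≤ y
divided-≤ Δ x y h = fromℕ-cancel-≤ (begin
  fromℕ (suc Δ * x)                        ≡⟨ fromℕ-* (suc Δ) x ⟩
  D ℚ.* fromℕ x                            ≡⟨ cong (D ℚ.*_) (ℕ→ℚ≡fromℕ x) ⟨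
  D ℚ.* ℕ→ℚ x                              ≤⟨ ℚP.*-monoˡ-≤-nonNeg D h ⟩
  D ℚ.* (1/ D ℚ.* ℕ→ℚ y)                   ≡⟨ ℚP.*-assoc D (1/ D) (ℕ→ℚ y) ⟨
  (D ℚ.* 1/ D) ℚ.* ℕ→ℚ y                   ≡⟨ cong (ℚ._* ℕ→ℚ y) (ℚP.*-inverseʳ D) ⟩
  1ℚ ℚ.* ℕ→ℚ y                             ≡⟨ trans (ℚP.*-identityˡ (ℕ→ℚ y)) (ℕ→ℚ≡fromℕ y) ⟩
  fromℕ y                                  ∎)
  where open ℚP.≤-Reasoning
        D = fromℕ (suc Δ)

multiplied-≤ : ∀ Q c x y → 1/ fromℕ (suc Q) ℚ.≤ c → c ℚ.* ℕ→ℚ x ℚ.≤ ℕ→ℚ y → x ≤ suc Q * y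
multiplied-≤ Q c x y 1/Q≤c h = fromℕ-cancel-≤ (begin
  fromℕ x                          ≡⟨ trans (sym (ℕ→ℚ≡fromℕ x)) (sym (ℚP.*-identityˡ (ℕ→ℚ x))) ⟩
  1ℚ ℚ.* ℕ→ℚ x                     ≡⟨ cong (ℚ._* ℕ→ℚ x) (ℚP.*-inverseʳ D) ⟨
  (D ℚ.* 1/ D) ℚ.* ℕ→ℚ x           ≡⟨ ℚP.*-assoc D (1/ D) (ℕ→ℚ x) ⟩
  D ℚ.* (1/ D ℚ.* ℕ→ℚ x)           ≤⟨ ℚP.*-monoˡ-≤-nonNeg D (ℚP.*-monoʳ-≤-nonNeg (ℕ→ℚ x) {{nonNeg x}} 1/Q≤c) ⟩
  D ℚ.* (c ℚ.* ℕ→ℚ x)              ≤⟨ ℚP.*-monoˡ-≤-nonNeg D h ⟩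
  D ℚ.* ℕ→ℚ y                      ≡⟨ cong (D ℚ.*_) (ℕ→ℚ≡fromℕ y) ⟩
  D ℚ.* fromℕ y                    ≡⟨ fromℕ-* (suc Q) y ⟨
  fromℕ (suc Q * y)                ∎)
  where open ℚP.≤-Reasoning
        D = fromℕ (suc Q)
        nonNeg : ∀ x → ℚ.NonNegative (ℕ→ℚ x)
        nonNeg x rewrite ℕ→ℚ≡fromℕ x = _

≥1/denominator : ∀ k q-1 .(cop : Coprime.Coprime (suc k) (suc q-1)) → 1/ fromℕ (suc q-1) ℚ.≤ mkℚ ℤ.+[1+ k ] q-1 cop
≥1/denominator k q-1 _ = *≤* (ℤP.*-monoʳ-≤-nonNeg (ℤ.+ suc q-1) {ℤ.+ 1} {ℤ.+[1+ k ]} (ℤ.+≤+ (s≤s z≤n)))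

probability-bound : ∀ d t m K → 0 < total (d ∸ 1) t m →
                    total (d ∸ 1) t m ≤ suc K * favourable (d ∸ 1) t m →
                    1/ fromℕ (suc K) ℚ.≤ probUnique d t m
probability-bound d t m K total>0 total≤Kfav with total (d ∸ 1) t m
... | suc k = ℚP.toℚᵘ-cancel-≤ (ℚᵘP.≤-respʳ-≃ (ℚᵘP.≃-sym (ℚP.toℚᵘ-fromℚᵘ (ℚᵘ.mkℚᵘ (ℤ.+ f) k)))
      (ℚᵘ.*≤* (subst₂ ℤ._≤_ (ℤP.pos-* 1 (suc k)) (ℤP.pos-* f (suc K))
        (ℤ.+≤+ (≤-trans (≤-reflexive (*-identityˡ (suc k))) (≤-trans total≤Kfav (≤-reflexive (*-comm (suc K) f))))))))
  where f = favourable (d ∸ 1) t m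

total-pos : ∀ n t m → t ≤ n → 0 < total n t m
total-pos n t m t≤n = subst (0 <_) (sym (total-as-product n t m))
  (*-mono-≤ (pow-pos (C-pos n t t≤n) m) (m^n>0 2 n))
  where pow-pos : ∀ {x} → 1 ≤ x → ∀ m → 1 ≤ x ^ m
        pow-pos x≥1 zero    = s≤s z≤n
        pow-pos x≥1 (suc m) = *-mono-≤ x≥1 (pow-pos x≥1 m)

UniqueBound : (a b c δ η : ℚ) → ℕ → Set
UniqueBound a b c δ η D =
  (d t m : ℕ) → d ≥ D → d ≥ 1 → t ≥ 1 → m ≥ 1 →
  (a ℚ.* a) ℚ.* ℕ→ℚ d ℚ.≤ ℕ→ℚ (t * t) →
  ℕ→ℚ (t * t) ℚ.≤ (b ℚ.* b) ℚ.* ℕ→ℚ d →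
  c ℚ.* ℕ→ℚ (2 ^ t) ℚ.≤ ℕ→ℚ m →
  ℕ→ℚ m ℚ.≤ δ ℚ.* ℕ→ℚ (2 ^ t) →
  η ℚ.≤ probUnique d t m

-- With B = ⌈b²⌉ the admissible density is δ = 1/(1 + 2·2^(8B)).
density-bound : ℚ → ℕ
density-bound b = suc (2 * 2 ^ (8 * natAbove (b ℚ.* b)))

unique-cover-bound : ∀ a b c Q → 1/ fromℕ (suc Q) ℚ.≤ c →
                     UniqueBound a b c (1/ fromℕ (density-bound b)) (1/ fromℕ (2 * suc Q)) (64 * natAbove (b ℚ.* b))
unique-cover-bound a b c Q 1/Q≤c zero    t m _ ()
unique-cover-bound a b c Q 1/Q≤c (suc n) t m d≥64B _ t≥1 _ _ t²≤b²d c2ᵗ≤m m≤δ2ᵗ =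
  from-parameters (parameters B n t (natAbove-pos (b ℚ.* b)) d≥64B t≥1 (scaled-≤ (b ℚ.* b) (t * t) (suc n) t²≤b²d))
  where
  B : ℕ
  B = natAbove (b ℚ.* b)
  from-parameters : (Σ ℕ λ a → Σ ℕ λ j → (a + 2 * t ≡ n) × (2 * j * (2 * t) ≤ suc a + 2 * t) × (t ≤ j * (8 * B))) →
                    1/ fromℕ (2 * suc Q) ℚ.≤ probUnique (suc n) t m
  from-parameters (a′ , j , a′+2t≡n , 2j2t≤d , t≤jc) =
    probability-bound (suc n) t m _ (total-pos n t m (≤-trans (m≤n+m t a′) (a+t≤a+2t a′ t a′+2t≡n)))
      (unique-cover-count n t m a′ j (8 * B) (density-bound b) (suc Q) a′+2t≡n 2j2t≤d t≤jc
        (divided-≤ (2 * 2 ^ (8 * B)) m (2 ^ t) m≤δ2ᵗ) (n≤1+n (2 * 2 ^ (8 * B))) (multiplied-≤ Q c (2 ^ t) m 1/Q≤c c2ᵗ≤m))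

lemma1 : (a b : ℚ) → 0ℚ ℚ.< a → a ℚ.≤ b →
         Σ ℚ λ δ → 0ℚ ℚ.< δ ×
         ((c : ℚ) → 0ℚ ℚ.< c →
          Σ ℚ λ η → 0ℚ ℚ.< η ×
          Σ ℕ λ D →
          ((d t m : ℕ) → d ≥ D → d ≥ 1 → t ≥ 1 → m ≥ 1 →
           (a ℚ.* a) ℚ.* ℕ→ℚ d ℚ.≤ ℕ→ℚ (t * t) →
           ℕ→ℚ (t * t) ℚ.≤ (b ℚ.* b) ℚ.* ℕ→ℚ d →
           c ℚ.* ℕ→ℚ (2 ^ t) ℚ.≤ ℕ→ℚ m →
           ℕ→ℚ m ℚ.≤ δ ℚ.* ℕ→ℚ (2 ^ t) →
           η ℚ.≤ probUnique d t m))
lemma1 a b _ _ = 1/ fromℕ (density-bound b) , *<* (ℤ.+<+ (s≤s z≤n)) , for-density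
  where
  for-density : (c : ℚ) → 0ℚ ℚ.< c → Σ ℚ λ η → 0ℚ ℚ.< η × Σ ℕ λ D → UniqueBound a b c (1/ fromℕ (density-bound b)) η D
  for-density c@(mkℚ ℤ.+[1+ k ] Q cop) _ =
    1/ fromℕ (2 * suc Q) , *<* (ℤ.+<+ (s≤s z≤n)) , 64 * natAbove (b ℚ.* b) ,
    unique-cover-bound a b c Q (≥1/denominator k Q cop)
  for-density c@(mkℚ ℤ.+0       _ _) c>0 = ⊥-elim (ℚP.<-irrefl (sym (ℚP.↥p≡0⇒p≡0 c refl)) c>0)
  for-density c@(mkℚ ℤ.-[1+ _ ] _ _) c>0 = ⊥-elim (ℚP.<-asym c>0 (ℚP.negative⁻¹ c))
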